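{- Let $G$ be a strongly connected directed graph and $W$ a walk in $G$. Then $W$ is a cut path if and only if $W$ is a subwalk of every $\mathrm{tail}(W)$-$\mathrm{head}(W)$ walk in $G$.
   Context: A walk $(w_1,\dots,w_\ell)$ is a sequence of nodes with $(w_i,w_{i+1})$ arcs; $\mathrm{tail}(W)=w_1$, $\mathrm{head}(W)=w_\ell$; a $u$-$v$ walk has tail $u$ and head $v$. A subwalk is a contiguous subsequence. A walk $W$ is a cut path if there exist nodes $u,v$ such that every $u$-$v$ walk in $G$ has $W$ as a subwalk. -}

module Defs where

open import Level using (Level; suc; _⊔_)
open import Data.List using (List; _++_)
open import Data.List.NonEmpty using (List⁺; toList; head; last)
open import Data.List.Relation.Unary.Linked using (Linked)
open import Data.Product using (Σ; _×_; ∃; ∃-syntax)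
open import Relation.Binary.PropositionalEquality using (_≡_)

record Digraph (ℓv ℓe : Level) : Set (suc (ℓv ⊔ ℓe)) where
  field
    Node : Set ℓv
    Arc  : Node → Node → Set ℓe

module _ {ℓv ℓe} (G : Digraph ℓv ℓe) where
  open Digraph G

  record Walk : Set (ℓv ⊔ ℓe) where
    constructor walk
    field
      nodes  : List⁺ Node
      linked : Linked Arc (toList nodes)
  open Walk public

  tail : Walk → Node
  tail W = head (nodes W)

  headW : Walk → Node
  headW W = last (nodes W)

  IsSubwalk : Walk → Walk → Set ℓv
  IsSubwalk W W' = ∃[ xs ] ∃[ ys ] (toList (nodes W') ≡ xs ++ toList (nodes W) ++ ys)

  IsWalkBetween : Node → Node → Walk → Set ℓv
  IsWalkBetween u v W = (tail W ≡ u) × (headW W ≡ v)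

  StronglyConnected : Set (ℓv ⊔ ℓe)
  StronglyConnected = ∀ u v → ∃[ W ] IsWalkBetween u v W

  IsCutPath : Walk → Set (ℓv ⊔ ℓe)
  IsCutPath W = ∃[ u ] ∃[ v ] (∀ (W' : Walk) → IsWalkBetween u v W' → IsSubwalk W W')

{-# OPTIONS --safe #-}
-- Let t = tail W and h = head W. If every u–v walk contains W, push u forward to t along a
-- u–t walk: prepending an arc x → y to a y–v walk X can only create a new occurrence of W
-- at the front, which forces x = t, and then the t–v walk under consideration is itself an
-- x–v walk. Symmetrically, pull v back to h along an h–v walk by appending arcs. Strong
-- connectivity supplies both walks.
module Submission where

open import Defs
open import Level using (_⊔_)
open import Function.Base using (id; _∘_; flip)
open import Function.Bundles using (_⇔_; mk⇔)
open import Data.List using ([]; _∷_; _++_; [_]; _∷ʳ_; initLast; _∷ʳ′_)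
open import Data.List.Properties using (++-assoc; ++-identityʳ; ∷-injective; ∷ʳ-injective)
open import Data.List.NonEmpty as List⁺ using (List⁺; _∷_; _∷⁺_; _⁺∷ʳ_; toList; last; snocView)
open import Data.List.Relation.Unary.Linked using (Linked; [-]; _∷_)
open import Data.Product using (∃-syntax; _,_; proj₁; proj₂)
open import Data.Sum using (_⊎_; inj₁; inj₂; reduce)
open import Relation.Binary.Definitions using (_Respects_)
open import Relation.Binary.Construct.Closure.ReflexiveTransitive using (Star; ε; _◅_)
open import Relation.Binary.PropositionalEquality using (_≡_; refl; sym; trans; cong; subst; subst₂; module ≡-Reasoning)
open ≡-Reasoning

module _ {a} {A : Set a} where

  toList-∷ʳ-last : (L : List⁺ A) → ∃[ xs ] toList L ≡ xs ∷ʳ last L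
  toList-∷ʳ-last L with snocView L
  ... | []       List⁺.∷ʳ′ y = [] , refl
  ... | (x ∷ xs) List⁺.∷ʳ′ y = x ∷ xs , refl

  last-∷ʳ : ∀ {L : List⁺ A} {xs y} → toList L ≡ xs ∷ʳ y → last L ≡ y
  last-∷ʳ {L} eq with ys , eq′ ← toList-∷ʳ-last L =
    proj₂ (∷ʳ-injective ys _ (trans (sym eq′) eq))

  last-∷⁺ : ∀ x (L : List⁺ A) → last (x ∷⁺ L) ≡ last L
  last-∷⁺ x (y ∷ ys) with xs , eq ← toList-∷ʳ-last (y ∷ ys) = last-∷ʳ {xs = x ∷ xs} (cong (x ∷_) eq)

module _ {a r} {A : Set a} {R : A → A → Set r} where

  linked-⁺∷ʳ : ∀ {y} (L : List⁺ A) → Linked R (toList L) → R (last L) y →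
               Linked R (toList (L ⁺∷ʳ y))
  linked-⁺∷ʳ (x ∷ [])      [-]      r = r ∷ [-]
  linked-⁺∷ʳ (x ∷ x′ ∷ xs) (r′ ∷ l) r =
    r′ ∷ linked-⁺∷ʳ (x′ ∷ xs) l (subst (λ z → R z _) (last-∷⁺ x (x′ ∷ xs)) r)

  linked⇒Star : (L : List⁺ A) → Linked R (toList L) → Star R (List⁺.head L) (last L)
  linked⇒Star (x ∷ [])     [-]     = ε
  linked⇒Star (x ∷ y ∷ ys) (r ∷ l) =
    r ◅ subst (Star R y) (sym (last-∷⁺ x (y ∷ ys))) (linked⇒Star (y ∷ ys) l)

module _ {a r p} {A : Set a} {R : A → A → Set r} (P : A → Set p) where

  Star-respects : P Respects R → P Respects Star R
  Star-respects resp ε        = id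
  Star-respects resp (r ◅ rs) = Star-respects resp rs ∘ resp r

  Star-respects-flip : P Respects flip R → P Respects flip (Star R)
  Star-respects-flip resp ε        = id
  Star-respects-flip resp (r ◅ rs) = resp r ∘ Star-respects-flip resp rs

module _ {ℓv ℓe} (G : Digraph ℓv ℓe) where
  open Digraph G

  walk⇒Star : (X : Walk G) → Star Arc (tail G X) (headW G X)
  walk⇒Star (walk L l) = linked⇒Star L l

  StronglyConnected⇒Star : StronglyConnected G → ∀ x y → Star Arc x y
  StronglyConnected⇒Star sc x y with X , tX , hX ← sc x y = subst₂ (Star Arc) tX hX (walk⇒Star X)

  cons : ∀ {x} (X : Walk G) → Arc x (tail G X) → Walk G
  cons {x} (walk (y ∷ ys) l) r = walk (x ∷ y ∷ ys) (r ∷ l)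

  cons-between : ∀ {x v} (X : Walk G) (r : Arc x (tail G X)) →
                 headW G X ≡ v → IsWalkBetween G x v (cons X r)
  cons-between (walk (y ∷ ys) _) r hX = refl , trans (last-∷⁺ _ (y ∷ ys)) hX

  subwalk-cons : ∀ {x} (W X : Walk G) (r : Arc x (tail G X)) →
                 IsSubwalk G W (cons X r) → IsSubwalk G W X ⊎ x ≡ tail G W
  subwalk-cons (walk (w ∷ ws) _) (walk (y ∷ ys) _) r ([]     , q , eq) = inj₂ (proj₁ (∷-injective eq))
  subwalk-cons W                 (walk (y ∷ ys) _) r (_ ∷ ps , q , eq) = inj₁ (ps , q , proj₂ (∷-injective eq))

  snoc : ∀ {y} (X : Walk G) → Arc (headW G X) y → Walk G
  snoc {y} (walk L l) r = walk (L ⁺∷ʳ y) (linked-⁺∷ʳ L l r)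

  snoc-between : ∀ {u y} (X : Walk G) (r : Arc (headW G X) y) →
                 tail G X ≡ u → IsWalkBetween G u y (snoc X r)
  snoc-between (walk (x ∷ xs) _) r tX = tX , last-∷ʳ {xs = x ∷ xs} refl

  subwalk-snoc : ∀ {y} (W X : Walk G) (r : Arc (headW G X) y) →
                 IsSubwalk G W (snoc X r) → IsSubwalk G W X ⊎ y ≡ headW G W
  subwalk-snoc {y} (walk L _) (walk (x ∷ xs) _) r (p , q , eq) with initLast q
  ... | [] with ws , eqL ← toList-∷ʳ-last L =
    inj₂ (proj₂ (∷ʳ-injective (x ∷ xs) (p ++ ws) (begin
      (x ∷ xs) ∷ʳ y          ≡⟨ eq ⟩
      p ++ toList L ++ []    ≡⟨ cong (p ++_) (trans (++-identityʳ (toList L)) eqL) ⟩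
      p ++ ws ∷ʳ last L      ≡⟨ ++-assoc p ws _ ⟨
      (p ++ ws) ∷ʳ last L    ∎)))
  ... | q′ ∷ʳ′ z =
    inj₁ (p , q′ , proj₁ (∷ʳ-injective (x ∷ xs) (p ++ toList L ++ q′) (begin
      (x ∷ xs) ∷ʳ y               ≡⟨ eq ⟩
      p ++ toList L ++ q′ ∷ʳ z    ≡⟨ cong (p ++_) (++-assoc (toList L) q′ [ z ]) ⟨
      p ++ (toList L ++ q′) ∷ʳ z  ≡⟨ ++-assoc p (toList L ++ q′) [ z ] ⟨
      (p ++ toList L ++ q′) ∷ʳ z  ∎)))

  Cut : Walk G → Node → Node → Set (ℓv ⊔ ℓe)
  Cut W u v = ∀ X → IsWalkBetween G u v X → IsSubwalk G W X

  cut-from-tail : ∀ {W u v} → Cut W u v → Star Arc u (tail G W) → Cut W (tail G W) v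
  cut-from-tail {W} {u} {v} cut u⇝t Y (tY , hY) =
    reduce (Star-respects Unless step u⇝t (λ X b → inj₁ (cut X b)) Y (tY , hY))
    where
    -- The disjunct "Y contains W" lets the case x = t be handled without deciding equality of nodes.
    Unless : Node → Set (ℓv ⊔ ℓe)
    Unless x = ∀ X → IsWalkBetween G x v X → IsSubwalk G W X ⊎ IsSubwalk G W Y

    step : Unless Respects Arc
    step r unless X (refl , hX) with unless (cons X r) (cons-between X r hX)
    ... | inj₂ s = inj₂ s
    ... | inj₁ s with subwalk-cons W X r s
    ...   | inj₁ s′  = inj₁ s′
    ...   | inj₂ x≡t = inj₂ (reduce (unless Y (trans tY (sym x≡t) , hY)))

  cut-to-head : ∀ {W u v} → Cut W u v → Star Arc (headW G W) v → Cut W u (headW G W)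
  cut-to-head {W} {u} {v} cut h⇝v Y (tY , hY) =
    reduce (Star-respects-flip Unless step h⇝v (λ X b → inj₁ (cut X b)) Y (tY , hY))
    where
    Unless : Node → Set (ℓv ⊔ ℓe)
    Unless z = ∀ X → IsWalkBetween G u z X → IsSubwalk G W X ⊎ IsSubwalk G W Y

    step : Unless Respects flip Arc
    step r unless X (tX , refl) with unless (snoc X r) (snoc-between X r tX)
    ... | inj₂ s = inj₂ s
    ... | inj₁ s with subwalk-snoc W X r s
    ...   | inj₁ s′  = inj₁ s′
    ...   | inj₂ z≡h = inj₂ (reduce (unless Y (tY , trans hY (sym z≡h))))

lemma9 : ∀ {ℓv ℓe} (G : Digraph ℓv ℓe) → StronglyConnected G → (W : Walk G) →
         IsCutPath G W ⇔
           (∀ (W' : Walk G) → IsWalkBetween G (tail G W) (headW G W) W' → IsSubwalk G W W')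
lemma9 G sc W = mk⇔
  (λ (u , v , cut) → cut-to-head G {W} (cut-from-tail G {W} cut (reach u (tail G W))) (reach (headW G W) v))
  (λ cut → tail G W , headW G W , cut)
  where
  reach : ∀ x y → Star (Digraph.Arc G) x y
  reach = StronglyConnected⇒Star G sc
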